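{- Let $M_{\mathrm S}$ be the rank-$4$ paving matroid on $[8]$ associated with the Steiner quadruple system $S(3,4,8)$, with dependent hyperplanes $\{1,2,4,8\},\{2,3,5,8\},\{3,4,6,8\},\{4,5,7,8\},\{1,5,6,8\},\{2,6,7,8\},\{1,3,7,8\},\{3,5,6,7\},\{1,4,6,7\},\{1,2,5,7\},\{1,2,3,6\},\{2,3,4,7\},\{1,3,4,5\},\{2,4,5,6\}$. For each $i\in[8]$, let $M_{\mathrm S}(i)$ be the matroid on $[8]$ whose circuits are the circuits of the deletion $M_{\mathrm S}\setminus i$ together with $\{i\}$. Then for every $i\in[8]$ the matroid $M_{\mathrm S}(i)$ is not realizable over $\mathbb{C}$, i.e. there is no tuple of $8$ vectors in $\mathbb{C}^4$ whose column matroid is $M_{\mathrm S}(i)$.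
   Context: A rank-$4$ paving matroid on $[d]$ with dependent hyperplanes $H_1,\dots,H_k$ is the matroid whose circuits are the $4$-subsets of the $H_j$ together with the $5$-subsets of $[d]$ containing no such $4$-subset. -}

module Defs where

open import Level using (Level; _⊔_) renaming (suc to lsuc)
open import Data.Nat using (ℕ; zero; suc)
open import Data.Fin using (Fin; zero; suc; toℕ)
open import Data.Fin.Subset using (Subset; _∈_; _∉_; _⊆_; ∣_∣; ⁅_⁆; _∪_; ⊥)
import Data.List
open import Data.List using (List; []; _∷_)
open import Data.Product using (Σ; ∃; _×_; _,_)
open import Data.Sum using (_⊎_)
open import Relation.Nullary using (¬_)
open import Relation.Binary.PropositionalEquality using (_≡_)
open import Function.Bundles using (_⇔_)
open import Algebra.Bundles using (CommutativeRing)

record Field (c ℓ : Level) : Set (lsuc (c ⊔ ℓ)) where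
  field
    commutativeRing : CommutativeRing c ℓ
  open CommutativeRing commutativeRing public
  field
    1≉0     : ¬ (1# ≈ 0#)
    inverse : ∀ x → ¬ (x ≈ 0#) → ∃ λ y → x * y ≈ 1#

module FieldOps {c ℓ} (K : Field c ℓ) where
  open Field K using (Carrier; 0#; 1#; _+_; _*_)

  natCast : ℕ → Carrier
  natCast zero    = 0#
  natCast (suc n) = 1# + natCast n

  pow : Carrier → ℕ → Carrier
  pow x zero    = 1#
  pow x (suc n) = x * pow x n

  sumFin : ∀ {n} → (Fin n → Carrier) → Carrier
  sumFin {zero}  f = 0#
  sumFin {suc n} f = f zero + sumFin (λ j → f (suc j))

CharZero : ∀ {c ℓ} → Field c ℓ → Set ℓ
CharZero K = ∀ n → natCast n ≈ 0# → n ≡ 0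
  where open Field K using (Carrier; _≈_; 0#; _+_; _*_) ; open FieldOps K

AlgClosed : ∀ {c ℓ} → Field c ℓ → Set (c ⊔ ℓ)
AlgClosed K = ∀ n (a : Fin (suc n) → Carrier) →
  ∃ λ x → pow x (suc n) + sumFin (λ k → a k * pow x (toℕ k)) ≈ 0#
  where open Field K using (Carrier; _≈_; 0#; _+_; _*_) ; open FieldOps K

fromList : ∀ {n} → List (Fin n) → Subset n
fromList []       = ⊥
fromList (x ∷ xs) = ⁅ x ⁆ ∪ fromList xs

CircuitFamily : ℕ → Set₁
CircuitFamily d = Subset d → Set

PavingCircuit4 : ∀ {d k} → (Fin k → Subset d) → CircuitFamily d
PavingCircuit4 {d} {k} H C =
  (∃ λ j → C ⊆ H j × ∣ C ∣ ≡ 4)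
  ⊎ (∣ C ∣ ≡ 5 × (∀ (D : Subset d) j → D ⊆ C → ∣ D ∣ ≡ 4 → ¬ (D ⊆ H j)))

Deletion : ∀ {d} → CircuitFamily d → Fin d → CircuitFamily d
Deletion M i C = M C × i ∉ C

AddLoop : ∀ {d} → CircuitFamily d → Fin d → CircuitFamily d
AddLoop M i C = Deletion M i C ⊎ C ≡ ⁅ i ⁆

Dependent : ∀ {d} → CircuitFamily d → Subset d → Set
Dependent M S = ∃ λ C → M C × C ⊆ S

module _ {c ℓ} (K : Field c ℓ) where
  open Field K using (Carrier; _≈_; 0#; _*_)
  open FieldOps K

  LinDependent : ∀ {d r} → (Fin d → Fin r → Carrier) → Subset d → Set (c ⊔ ℓ)
  LinDependent {d} {r} v S =
    ∃ λ (coef : Fin d → Carrier) →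
      (∀ j → j ∉ S → coef j ≈ 0#)
      × (∃ λ j → ¬ (coef j ≈ 0#))
      × (∀ t → sumFin (λ j → coef j * v j t) ≈ 0#)

  ColumnMatroidIs : ∀ {d r} → (Fin d → Fin r → Carrier) → CircuitFamily d → Set (c ⊔ ℓ)
  ColumnMatroidIs {d} v M = ∀ (S : Subset d) → LinDependent v S ⇔ Dependent M S

  Realizable : ∀ {d} (r : ℕ) → CircuitFamily d → Set (c ⊔ ℓ)
  Realizable {d} r M = ∃ λ (v : Fin d → Fin r → Carrier) → ColumnMatroidIs v M

-- The Steiner quadruple system S(3,4,8).  Element m of [8] is
-- represented by the Fin 8 value m - 1.

pattern e1 = zero
pattern e2 = suc zero
pattern e3 = suc (suc zero)
pattern e4 = suc (suc (suc zero))
pattern e5 = suc (suc (suc (suc zero)))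
pattern e6 = suc (suc (suc (suc (suc zero))))
pattern e7 = suc (suc (suc (suc (suc (suc zero)))))
pattern e8 = suc (suc (suc (suc (suc (suc (suc zero))))))

steinerHyperplanes : Fin 14 → Subset 8
steinerHyperplanes j = fromList (Data.Vec.lookup table j)
  where
  open import Data.Vec using (Vec; _∷_; [])
  table : Vec (List (Fin 8)) 14
  table = (e1 ∷ e2 ∷ e4 ∷ e8 ∷ L.[])
        ∷ (e2 ∷ e3 ∷ e5 ∷ e8 ∷ L.[])
        ∷ (e3 ∷ e4 ∷ e6 ∷ e8 ∷ L.[])
        ∷ (e4 ∷ e5 ∷ e7 ∷ e8 ∷ L.[])
        ∷ (e1 ∷ e5 ∷ e6 ∷ e8 ∷ L.[])
        ∷ (e2 ∷ e6 ∷ e7 ∷ e8 ∷ L.[])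
        ∷ (e1 ∷ e3 ∷ e7 ∷ e8 ∷ L.[])
        ∷ (e3 ∷ e5 ∷ e6 ∷ e7 ∷ L.[])
        ∷ (e1 ∷ e4 ∷ e6 ∷ e7 ∷ L.[])
        ∷ (e1 ∷ e2 ∷ e5 ∷ e7 ∷ L.[])
        ∷ (e1 ∷ e2 ∷ e3 ∷ e6 ∷ L.[])
        ∷ (e2 ∷ e3 ∷ e4 ∷ e7 ∷ L.[])
        ∷ (e1 ∷ e3 ∷ e4 ∷ e5 ∷ L.[])
        ∷ (e2 ∷ e4 ∷ e5 ∷ e6 ∷ L.[])
        ∷ []
    where module L = Data.List

M-S : CircuitFamily 8
M-S = PavingCircuit4 steinerHyperplanes

M-S[_] : Fin 8 → CircuitFamily 8
M-S[ i ] = AddLoop M-S i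

{-# OPTIONS --safe #-}
module Submission where

-- Deleting the loop i leaves the rank-4 paving matroid on the other seven points whose
-- circuit-hyperplanes are the complements of the lines of a Fano plane: the dual Fano matroid.
-- Label the seven points 0..6 so that 0123 is a basis and 0234, 0125, 1236 are circuits; the
-- relations p, q, r of these three circuits span every relation of the configuration, since a
-- relation is determined by its coefficients at 4, 5, 6 (0123 being independent).  Each of the
-- remaining circuits 2456, 0356, 0146, 1345 therefore makes a minor of the 4 × 3 matrix (p q r)
-- on the rows 0..3 vanish: one 3 × 3 minor gives p₀q₁r₃ + q₀r₁p₃ = 0, and the product of the
-- three 2 × 2 minors gives p₀q₁r₃ = q₀r₁p₃, so 2 = 0.

open import Defs
open import Level using (_⊔_)
open import Data.Nat as ℕ using (_≤_; _≤?_; s≤s; z≤n)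
open import Data.Nat.Properties using (≤-trans; ≤-reflexive; +-suc; m≤n⇒m≤1+n)
open import Data.Fin using (Fin; suc; _≟_)
open import Data.Fin.Patterns using (0F; 1F; 2F; 3F; 4F; 5F; 6F)
open import Data.Fin.Properties using (all?; any?)
open import Data.Fin.Subset using (Subset; _∈_; _∉_; _⊆_; ∣_∣; ⁅_⁆; _∪_; _∩_; inside; outside)
open import Data.Fin.Subset.Properties
  using (_∈?_; _⊆?_; x∈p∪q⁻; x∈p∪q⁺; x∈⁅y⁆⇒x≡y; x∈⁅x⁆; ∉⊥; ∣⁅x⁆∣≡1; ∣⊥∣≡0;
         x∈p∩q⁺; p⊆q⇒∣p∣≤∣q∣; ∣p∩q∣≤∣p∣)
open import Data.List using (List; []; _∷_; map; length; filter)
open import Data.List.Properties using (length-map)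
open import Data.List.Membership.Propositional using () renaming (_∈_ to _∈ₗ_; _∉_ to _∉ₗ_)
open import Data.List.Membership.Propositional.Properties using (∈-map⁺; ∈-map⁻; ∈-filter⁺)
open import Data.List.Membership.DecPropositional (_≟_ {7}) using () renaming (_∈?_ to _∈ₗ?_)
open import Data.List.Relation.Unary.Any using (here; there)
open import Data.List.Relation.Unary.All as All using (All; []; _∷_)
open import Data.Vec using (Vec; lookup; _∷_; [])
open import Data.Product using (∃; _×_; _,_; proj₁)
open import Data.Sum using (inj₁; inj₂)
open import Data.Empty using (⊥-elim)
open import Function using (_∘_)
open import Function.Bundles using (Equivalence)
open import Function.Definitions using (Injective)
open import Effect.Monad using (RawMonad)
open import Relation.Nullary using (¬_; yes; no; ¬?; contraposition)
open import Relation.Nullary.Decidable using (True; False; toWitness; toWitnessFalse; from-yes; _×-dec_; _→-dec_)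
open import Relation.Nullary.Negation using (¬¬-Monad; ¬¬-map)
open import Relation.Binary.PropositionalEquality using (_≡_; _≢_; refl; cong; cong₂)
import Relation.Binary.PropositionalEquality as ≡

module FieldProperties {c ℓ} (K : Field c ℓ) where
  open Field K renaming (refl to ≈-refl)
  open import Relation.Binary.Reasoning.Setoid setoid
  open import Algebra.Solver.Ring.NaturalCoefficients.Default commutativeSemiring

  x≈0⇒y*x≈0 : ∀ {x} y → x ≈ 0# → y * x ≈ 0#
  x≈0⇒y*x≈0 y x≈0 = trans (*-congˡ x≈0) (zeroʳ y)

  x≈0⇒x*y≈0 : ∀ {x} y → x ≈ 0# → x * y ≈ 0#
  x≈0⇒x*y≈0 y x≈0 = trans (*-congʳ x≈0) (zeroˡ y)

  drop-first : ∀ {x y z} → x ≈ 0# → x + (y + z) ≈ 0# → y + z ≈ 0#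
  drop-first x≈0 sum≈0 = trans (sym (trans (+-congʳ x≈0) (+-identityˡ _))) sum≈0

  drop-middle : ∀ {x y z} → y ≈ 0# → x + (y + z) ≈ 0# → x + z ≈ 0#
  drop-middle y≈0 sum≈0 = trans (+-congˡ (sym (trans (+-congʳ y≈0) (+-identityˡ _)))) sum≈0

  drop-last : ∀ {x y z} → z ≈ 0# → x + (y + z) ≈ 0# → x + y ≈ 0#
  drop-last z≈0 sum≈0 = trans (+-congˡ (sym (trans (+-congˡ z≈0) (+-identityʳ _)))) sum≈0

  *-cancelˡ : ∀ {x y z} → x ≉ 0# → x * y ≈ x * z → y ≈ z
  *-cancelˡ {x} {y} {z} x≉0 xy≈xz with inverse x x≉0
  ... | x⁻¹ , xx⁻¹≈1 = begin
    y              ≈⟨ undo y ⟩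
    x⁻¹ * (x * y)  ≈⟨ *-congˡ xy≈xz ⟩
    x⁻¹ * (x * z)  ≈⟨ undo z ⟨
    z              ∎
    where
    undo : ∀ w → w ≈ x⁻¹ * (x * w)
    undo w = begin
      w              ≈⟨ *-identityˡ w ⟨
      1# * w         ≈⟨ *-congʳ xx⁻¹≈1 ⟨
      x * x⁻¹ * w    ≈⟨ solve 3 (λ x x⁻¹ w → x :* x⁻¹ :* w := x⁻¹ :* (x :* w)) ≈-refl x x⁻¹ w ⟩
      x⁻¹ * (x * w)  ∎

  x*y≈0⇒y≈0 : ∀ {x y} → x ≉ 0# → x * y ≈ 0# → y ≈ 0#
  x*y≈0⇒y≈0 {x} x≉0 xy≈0 = *-cancelˡ x≉0 (trans xy≈0 (sym (zeroʳ x)))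

  *-≉0 : ∀ {x y} → x ≉ 0# → y ≉ 0# → x * y ≉ 0#
  *-≉0 x≉0 y≉0 xy≈0 = y≉0 (x*y≈0⇒y≈0 x≉0 xy≈0)

  det₂≈0 : ∀ {β γ a b c e} → β ≉ 0# →
    β * a + γ * b ≈ 0# → β * c + γ * e ≈ 0# → a * e ≈ c * b
  det₂≈0 {β} {γ} {a} {b} {c} {e} β≉0 row₁ row₂ = *-cancelˡ β≉0 (begin
    β * (a * e)                            ≈⟨ +-identityʳ _ ⟨
    β * (a * e) + 0#                       ≈⟨ +-congˡ (x≈0⇒y*x≈0 b row₂) ⟨
    β * (a * e) + b * (β * c + γ * e)      ≈⟨ solve 6 (λ β γ a b c e →
                                                β :* (a :* e) :+ b :* (β :* c :+ γ :* e)
                                             := e :* (β :* a :+ γ :* b) :+ β :* (c :* b)) ≈-refl β γ a b c e ⟩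
    e * (β * a + γ * b) + β * (c * b)      ≈⟨ +-congʳ (x≈0⇒y*x≈0 e row₁) ⟩
    0# + β * (c * b)                       ≈⟨ +-identityˡ _ ⟩
    β * (c * b)                            ∎)

  -- (β, γ, δ) is a kernel vector of [[a, b, 0], [0, e, f], [g, 0, h]], whose determinant is
  -- a e h + b f g.
  det₃≈0 : ∀ {β γ δ a b e f g h} → β ≉ 0# →
    β * a + γ * b ≈ 0# → γ * e + δ * f ≈ 0# → β * g + δ * h ≈ 0# →
    a * (e * h) + b * (f * g) ≈ 0#
  det₃≈0 {β} {γ} {δ} {a} {b} {e} {f} {g} {h} β≉0 row₁ row₂ row₃ = x*y≈0⇒y≈0 β≉0 (begin
    β * det
      ≈⟨ +-identityʳ _ ⟨
    β * det + 0#
      ≈⟨ +-congˡ (x≈0⇒y*x≈0 (b * h) row₂) ⟨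
    β * det + b * h * (γ * e + δ * f)
      ≈⟨ solve 9 (λ β γ δ a b e f g h →
                     β :* (a :* (e :* h) :+ b :* (f :* g)) :+ b :* h :* (γ :* e :+ δ :* f)
                  := e :* h :* (β :* a :+ γ :* b) :+ b :* f :* (β :* g :+ δ :* h))
           ≈-refl β γ δ a b e f g h ⟩
    e * h * (β * a + γ * b) + b * f * (β * g + δ * h)
      ≈⟨ +-cong (x≈0⇒y*x≈0 (e * h) row₁) (x≈0⇒y*x≈0 (b * f) row₃) ⟩
    0# + 0#
      ≈⟨ +-identityˡ 0# ⟩
    0# ∎)
    where
    det : Carrier
    det = a * (e * h) + b * (f * g)

  -- (p₀ / q₀) (q₁ / r₁) (r₃ / p₃) = (p₂ / q₂) (q₂ / r₂) (r₂ / p₂) = 1, with denominators cleared.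
  ratio-product : ∀ {p₀ p₂ p₃ q₀ q₁ q₂ r₁ r₂ r₃} → p₂ ≉ 0# → q₂ ≉ 0# → r₂ ≉ 0# →
    q₁ * r₂ ≈ q₂ * r₁ → p₂ * r₃ ≈ p₃ * r₂ → p₀ * q₂ ≈ p₂ * q₀ →
    p₀ * (q₁ * r₃) ≈ q₀ * (r₁ * p₃)
  ratio-product {p₀} {p₂} {p₃} {q₀} {q₁} {q₂} {r₁} {r₂} {r₃} p₂≉0 q₂≉0 r₂≉0 e₁ e₂ e₃ =
    *-cancelˡ (*-≉0 p₂≉0 (*-≉0 q₂≉0 r₂≉0)) (begin
      p₂ * (q₂ * r₂) * (p₀ * (q₁ * r₃))
        ≈⟨ solve 9 (λ p₀ p₂ p₃ q₀ q₁ q₂ r₁ r₂ r₃ →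
                       p₂ :* (q₂ :* r₂) :* (p₀ :* (q₁ :* r₃)) := p₀ :* q₂ :* (q₁ :* r₂ :* (p₂ :* r₃)))
             ≈-refl p₀ p₂ p₃ q₀ q₁ q₂ r₁ r₂ r₃ ⟩
      p₀ * q₂ * (q₁ * r₂ * (p₂ * r₃))
        ≈⟨ *-cong e₃ (*-cong e₁ e₂) ⟩
      p₂ * q₀ * (q₂ * r₁ * (p₃ * r₂))
        ≈⟨ solve 9 (λ p₀ p₂ p₃ q₀ q₁ q₂ r₁ r₂ r₃ →
                       p₂ :* q₀ :* (q₂ :* r₁ :* (p₃ :* r₂)) := p₂ :* (q₂ :* r₂) :* (q₀ :* (r₁ :* p₃)))
             ≈-refl p₀ p₂ p₃ q₀ q₁ q₂ r₁ r₂ r₃ ⟩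
      p₂ * (q₂ * r₂) * (q₀ * (r₁ * p₃)) ∎)

  x+x≈0⇒1+1≈0 : ∀ {x} → x ≉ 0# → x + x ≈ 0# → 1# + 1# ≈ 0#
  x+x≈0⇒1+1≈0 {x} x≉0 x+x≈0 = x*y≈0⇒y≈0 x≉0 (begin
    x * (1# + 1#)  ≈⟨ solve 1 (λ x → x :* (con 1 :+ con 1) := x :+ x) ≈-refl x ⟩
    x + x          ≈⟨ x+x≈0 ⟩
    0#             ∎)

  1+1≉0 : CharZero K → 1# + 1# ≉ 0#
  1+1≉0 char0 1+1≈0 with char0 2 (trans (+-congˡ (+-identityʳ 1#)) 1+1≈0)
  ... | ()

∣p∪q∣≤∣p∣+∣q∣ : ∀ {n} (p q : Subset n) → ∣ p ∪ q ∣ ≤ ∣ p ∣ ℕ.+ ∣ q ∣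
∣p∪q∣≤∣p∣+∣q∣ []            []            = z≤n
∣p∪q∣≤∣p∣+∣q∣ (inside ∷ p)  (inside ∷ q)  rewrite +-suc ∣ p ∣ ∣ q ∣ = s≤s (m≤n⇒m≤1+n (∣p∪q∣≤∣p∣+∣q∣ p q))
∣p∪q∣≤∣p∣+∣q∣ (inside ∷ p)  (outside ∷ q) = s≤s (∣p∪q∣≤∣p∣+∣q∣ p q)
∣p∪q∣≤∣p∣+∣q∣ (outside ∷ p) (inside ∷ q)  rewrite +-suc ∣ p ∣ ∣ q ∣ = s≤s (∣p∪q∣≤∣p∣+∣q∣ p q)
∣p∪q∣≤∣p∣+∣q∣ (outside ∷ p) (outside ∷ q) = ∣p∪q∣≤∣p∣+∣q∣ p q

∣fromList∣≤length : ∀ {n} (l : List (Fin n)) → ∣ fromList l ∣ ≤ length l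
∣fromList∣≤length {n} []    = ≤-reflexive (∣⊥∣≡0 n)
∣fromList∣≤length (a ∷ l) = ≤-trans (∣p∪q∣≤∣p∣+∣q∣ ⁅ a ⁆ (fromList l))
  (≤-trans (≤-reflexive (cong (ℕ._+ ∣ fromList l ∣) (∣⁅x⁆∣≡1 a))) (s≤s (∣fromList∣≤length l)))

∈-fromList⁻ : ∀ {n} {j : Fin n} l → j ∈ fromList l → j ∈ₗ l
∈-fromList⁻ []      j∈ = ⊥-elim (∉⊥ j∈)
∈-fromList⁻ (a ∷ l) j∈ with x∈p∪q⁻ ⁅ a ⁆ (fromList l) j∈
... | inj₁ j∈⁅a⁆ = here (x∈⁅y⁆⇒x≡y a j∈⁅a⁆)
... | inj₂ j∈l   = there (∈-fromList⁻ l j∈l)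

∈-fromList⁺ : ∀ {n} {j : Fin n} {l} → j ∈ₗ l → j ∈ fromList l
∈-fromList⁺ {l = a ∷ _} (here refl) = x∈p∪q⁺ (inj₁ (x∈⁅x⁆ a))
∈-fromList⁺ {l = a ∷ _} (there j∈l) = x∈p∪q⁺ {p = ⁅ a ⁆} (inj₂ (∈-fromList⁺ j∈l))

_without_ : ∀ {n} → List (Fin n) → Fin n → List (Fin n)
l without k = filter (λ m → ¬? (m ≟ k)) l

image : ∀ {m n} → (Fin m → Fin n) → List (Fin m) → Subset n
image x l = fromList (map x l)

module _ {m n} (x : Fin m → Fin n) where

  ∈-image⁻ : ∀ {j} l → j ∈ image x l → ∃ λ k → k ∈ₗ l × j ≡ x k
  ∈-image⁻ l j∈ = ∈-map⁻ x (∈-fromList⁻ (map x l) j∈)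

  ∈-image⁺ : ∀ {k} l → k ∈ₗ l → x k ∈ image x l
  ∈-image⁺ _ k∈l = ∈-fromList⁺ (∈-map⁺ x k∈l)

  ∉-image : Injective _≡_ _≡_ x → ∀ {k l} → k ∉ₗ l → x k ∉ image x l
  ∉-image x-injective {l = l} k∉l xk∈ with ∈-image⁻ l xk∈
  ... | _ , k′∈l , xk≡xk′ rewrite x-injective xk≡xk′ = k∉l k′∈l

  image-avoids : ∀ {i} → (∀ k → x k ≢ i) → ∀ l → i ∉ image x l
  image-avoids x≢i l i∈ with ∈-image⁻ l i∈
  ... | k , _ , i≡xk = x≢i k (≡.sym i≡xk)

  ∈-image-without : ∀ {j k} l → j ∈ image x l → j ≢ x k → j ∈ image x (l without k)
  ∈-image-without {k = k} l j∈ j≢xk with ∈-image⁻ l j∈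
  ... | m , m∈l , refl = ∈-image⁺ (l without k) (∈-filter⁺ (λ m → ¬? (m ≟ k)) m∈l (j≢xk ∘ cong x))

  ∣image∣≤length : ∀ l → ∣ image x l ∣ ≤ length l
  ∣image∣≤length l = ≤-trans (∣fromList∣≤length (map x l)) (≤-reflexive (length-map x l))

module PavingWithLoop {d k} (H : Fin k → Subset d) (i : Fin d) where

  ⊆-hyperplane⇒dependent : ∀ {C} j → C ⊆ H j → ∣ C ∣ ≡ 4 → i ∉ C →
    Dependent (AddLoop (PavingCircuit4 H) i) C
  ⊆-hyperplane⇒dependent j C⊆Hj ∣C∣≡4 i∉C = _ , inj₁ (inj₁ (j , C⊆Hj , ∣C∣≡4) , i∉C) , λ j∈C → j∈C

  sparse⇒independent : ∀ {S} → i ∉ S → ∣ S ∣ ≤ 4 → (∀ j → ∣ S ∩ H j ∣ ≤ 3) →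
    ¬ Dependent (AddLoop (PavingCircuit4 H) i) S
  sparse⇒independent i∉S _ _ (_ , inj₂ refl , C⊆S) = i∉S (C⊆S (x∈⁅x⁆ i))
  sparse⇒independent {S} _ _ sparse (C , inj₁ (inj₁ (j , C⊆Hj , ∣C∣≡4) , _) , C⊆S) =
    4≰3 (≡.subst (_≤ 3) ∣C∣≡4 (≤-trans (p⊆q⇒∣p∣≤∣q∣ C⊆S∩Hj) (sparse j)))
    where
    C⊆S∩Hj : C ⊆ S ∩ H j
    C⊆S∩Hj x∈C = x∈p∩q⁺ (C⊆S x∈C , C⊆Hj x∈C)
    4≰3 : ¬ 4 ≤ 3
    4≰3 (s≤s (s≤s (s≤s ())))
  sparse⇒independent _ ∣S∣≤4 _ (C , inj₁ (inj₂ (∣C∣≡5 , _) , _) , C⊆S) =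
    5≰4 (≡.subst (_≤ 4) ∣C∣≡5 (≤-trans (p⊆q⇒∣p∣≤∣q∣ C⊆S) ∣S∣≤4))
    where
    5≰4 : ¬ 5 ≤ 4
    5≰4 (s≤s (s≤s (s≤s (s≤s ()))))

  ∣S∣≤3⇒independent : ∀ {S} → i ∉ S → ∣ S ∣ ≤ 3 → ¬ Dependent (AddLoop (PavingCircuit4 H) i) S
  ∣S∣≤3⇒independent {S} i∉S ∣S∣≤3 =
    sparse⇒independent i∉S (m≤n⇒m≤1+n ∣S∣≤3) (λ j → ≤-trans (∣p∩q∣≤∣p∣ S (H j)) ∣S∣≤3)

module LinearRelations {c ℓ} (K : Field c ℓ) {d n} (v : Fin d → Fin n → Field.Carrier K) where
  open Field K hiding (refl)
  open FieldOps K using (sumFin)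
  open import Relation.Binary.Reasoning.Setoid setoid
  open import Algebra.Properties.Semiring.Sum semiring using (sum; sum-cong-≋; ∑-distrib-+; *-distribˡ-sum)
  open import Algebra.Properties.Ring ring using (-1*x≈-x; x∙y⁻¹≈ε⇒x≈y; x≈y⇒x∙y⁻¹≈ε)

  IsRelation : (Fin d → Carrier) → Set ℓ
  IsRelation a = ∀ t → sumFin (λ j → a j * v j t) ≈ 0#

  Independent : Subset d → Set (c ⊔ ℓ)
  Independent S = ¬ LinDependent K v S

  supported : ∀ {S} (dep : LinDependent K v S) → ∀ j → j ∉ S → proj₁ dep j ≈ 0#
  supported (_ , coef-supported , _) = coef-supported

  relation : ∀ {S} (dep : LinDependent K v S) → IsRelation (proj₁ dep)
  relation (_ , _ , _ , rel) = rel

  sumFin≡sum : ∀ {m} (f : Fin m → Carrier) → sumFin f ≡ sum f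
  sumFin≡sum {ℕ.zero}  f = refl
  sumFin≡sum {ℕ.suc m} f = cong (f 0F +_) (sumFin≡sum (f ∘ suc))

  relation-+ : ∀ {a b} → IsRelation a → IsRelation b → IsRelation (λ j → a j + b j)
  relation-+ {a} {b} rel-a rel-b t = begin
    sumFin (λ j → (a j + b j) * v j t)                   ≡⟨ sumFin≡sum {d} _ ⟩
    sum (λ j → (a j + b j) * v j t)                      ≈⟨ sum-cong-≋ (λ j → distribʳ (v j t) (a j) (b j)) ⟩
    sum (λ j → a j * v j t + b j * v j t)                ≈⟨ ∑-distrib-+ (λ j → a j * v j t) (λ j → b j * v j t) ⟩
    sum (λ j → a j * v j t) + sum (λ j → b j * v j t)    ≡⟨ cong₂ _+_ (sumFin≡sum {d} _) (sumFin≡sum {d} _) ⟨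
    sumFin (λ j → a j * v j t) + sumFin (λ j → b j * v j t) ≈⟨ +-cong (rel-a t) (rel-b t) ⟩
    0# + 0#                                              ≈⟨ +-identityˡ 0# ⟩
    0#                                                   ∎

  relation-* : ∀ x {a} → IsRelation a → IsRelation (λ j → x * a j)
  relation-* x {a} rel-a t = begin
    sumFin (λ j → x * a j * v j t)    ≡⟨ sumFin≡sum {d} _ ⟩
    sum (λ j → x * a j * v j t)       ≈⟨ sum-cong-≋ (λ j → *-assoc x (a j) (v j t)) ⟩
    sum (λ j → x * (a j * v j t))     ≈⟨ *-distribˡ-sum x (λ j → a j * v j t) ⟨
    x * sum (λ j → a j * v j t)       ≡⟨ cong (x *_) (sumFin≡sum {d} _) ⟨
    x * sumFin (λ j → a j * v j t)    ≈⟨ *-congˡ (rel-a t) ⟩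
    x * 0#                            ≈⟨ zeroʳ x ⟩
    0#                                ∎

  -- Equality in K is not decidable, so independence only refutes a ≉ b coordinatewise; the
  -- double negation is discharged at the end, where the goal is ⊥.
  relations-agree : ∀ {S a b} → Independent S → IsRelation a → IsRelation b →
    (∀ j → j ∉ S → a j ≈ b j) → ∀ j → ¬ ¬ (a j ≈ b j)
  relations-agree {S} {a} {b} S-independent rel-a rel-b agree-off j aj≉bj =
    S-independent (a-b , a-b-supported , (j , aj≉bj ∘ agree) , relation-+ rel-a (relation-* (- 1#) rel-b))
    where
    a-b : Fin d → Carrier
    a-b k = a k + - 1# * b k
    a-b≈a+-b : ∀ k → a-b k ≈ a k + - b k
    a-b≈a+-b k = +-congˡ (-1*x≈-x (b k))
    agree : a-b j ≈ 0# → a j ≈ b j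
    agree a-b≈0 = x∙y⁻¹≈ε⇒x≈y (a j) (b j) (trans (sym (a-b≈a+-b j)) a-b≈0)
    a-b-supported : ∀ k → k ∉ S → a-b k ≈ 0#
    a-b-supported k k∉S = trans (a-b≈a+-b k) (x≈y⇒x∙y⁻¹≈ε (agree-off k k∉S))

  circuit-coef≉0 : ∀ {S T a} (dep : LinDependent K v S) → Independent T →
    (∀ j → j ∈ S → j ≢ a → j ∈ T) → proj₁ dep a ≉ 0#
  circuit-coef≉0 {S} {T} {a} (coef , coef-supported , nonzero , rel) T-independent S-a⊆T coef-a≈0 =
    T-independent (coef , supported-in-T , nonzero , rel)
    where
    supported-in-T : ∀ j → j ∉ T → coef j ≈ 0#
    supported-in-T j j∉T with j ∈? S | j ≟ a
    ... | no j∉S  | _        = coef-supported j j∉S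
    ... | yes _   | yes refl = coef-a≈0
    ... | yes j∈S | no j≢a   = ⊥-elim (j∉T (S-a⊆T j j∈S j≢a))

-- The dual Fano matroid on Fin 7: its circuit-hyperplanes are the complements of the lines
-- 156, 346, 045, 013, 124, 235, 026 of a Fano plane, and basis is the complement of the triangle 456.
basis C₀₂₃₄ C₀₁₂₅ C₁₂₃₆ C₂₄₅₆ C₀₃₅₆ C₀₁₄₆ C₁₃₄₅ : List (Fin 7)
basis = 0F ∷ 1F ∷ 2F ∷ 3F ∷ []
C₀₂₃₄ = 0F ∷ 2F ∷ 3F ∷ 4F ∷ []
C₀₁₂₅ = 0F ∷ 1F ∷ 2F ∷ 5F ∷ []
C₁₂₃₆ = 1F ∷ 2F ∷ 3F ∷ 6F ∷ []
C₂₄₅₆ = 2F ∷ 4F ∷ 5F ∷ 6F ∷ []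
C₀₃₅₆ = 0F ∷ 3F ∷ 5F ∷ 6F ∷ []
C₀₁₄₆ = 0F ∷ 1F ∷ 4F ∷ 6F ∷ []
C₁₃₄₅ = 1F ∷ 3F ∷ 4F ∷ 5F ∷ []

dualFanoCircuits : List (List (Fin 7))
dualFanoCircuits = C₀₂₃₄ ∷ C₀₁₂₅ ∷ C₁₂₃₆ ∷ C₂₄₅₆ ∷ C₀₃₅₆ ∷ C₀₁₄₆ ∷ C₁₃₄₅ ∷ []

module DualFanoFrame {c ℓ} (K : Field c ℓ) {d n} (v : Fin d → Fin n → Field.Carrier K)
  (x : Fin 7 → Fin d) (x-injective : Injective _≡_ _≡_ x)
  (basis-independent : LinearRelations.Independent K v (image x basis))
  (small-independent : ∀ l → length l ≤ 3 → LinearRelations.Independent K v (image x l))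
  (dP : LinDependent K v (image x C₀₂₃₄))
  (dQ : LinDependent K v (image x C₀₁₂₅))
  (dR : LinDependent K v (image x C₁₂₃₆))
  where

  open Field K renaming (refl to ≈-refl)
  open LinearRelations K v
  open FieldProperties K
  open RawMonad (¬¬-Monad {ℓ})
  open import Relation.Binary.Reasoning.Setoid setoid
  open import Algebra.Solver.Ring.NaturalCoefficients.Default commutativeSemiring

  coef : ∀ {S} → LinDependent K v S → Fin 7 → Carrier
  coef dep k = proj₁ dep (x k)

  vanishes : ∀ l (dep : LinDependent K v (image x l)) k {k∉l : False (k ∈ₗ? l)} → coef dep k ≈ 0#
  vanishes _ dep k {k∉l} = supported dep (x k) (∉-image x x-injective (toWitnessFalse k∉l))

  coef≉0 : ∀ l (dep : LinDependent K v (image x l)) k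
    {short : True (length (l without k) ≤? 3)} → coef dep k ≉ 0#
  coef≉0 l dep k {short} =
    circuit-coef≉0 dep (small-independent (l without k) (toWitness short)) (λ _ → ∈-image-without x l)

  p q r : Fin 7 → Carrier
  p = coef dP
  q = coef dQ
  r = coef dR

  -- u = (u₄ / p₄) p + (u₅ / q₅) q + (u₆ / r₆) r for every relation u, with denominators cleared.
  α : Carrier
  α = p 4F * (q 5F * r 6F)

  β γ δ : ∀ {S} → LinDependent K v S → Carrier
  β dep = coef dep 4F * (q 5F * r 6F)
  γ dep = coef dep 5F * (p 4F * r 6F)
  δ dep = coef dep 6F * (p 4F * q 5F)

  outside-frame : ∀ {j} l → j ∉ image x basis → j ≢ x 4F → j ≢ x 5F → j ≢ x 6F → j ∉ image x l
  outside-frame l j∉B j≢x₄ j≢x₅ j≢x₆ j∈ with ∈-image⁻ x l j∈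
  ... | 0F , _ , refl = j∉B (∈-image⁺ x basis (here refl))
  ... | 1F , _ , refl = j∉B (∈-image⁺ x basis (there (here refl)))
  ... | 2F , _ , refl = j∉B (∈-image⁺ x basis (there (there (here refl))))
  ... | 3F , _ , refl = j∉B (∈-image⁺ x basis (there (there (there (here refl)))))
  ... | 4F , _ , refl = j≢x₄ refl
  ... | 5F , _ , refl = j≢x₅ refl
  ... | 6F , _ , refl = j≢x₆ refl

  agree-off-basis : ∀ l (dep : LinDependent K v (image x l)) j → j ∉ image x basis →
    α * proj₁ dep j ≈ β dep * proj₁ dP j + (γ dep * proj₁ dQ j + δ dep * proj₁ dR j)
  agree-off-basis l dep j j∉B with j ≟ x 4F | j ≟ x 5F | j ≟ x 6F
  ... | yes refl | _ | _ = begin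
    α * coef dep 4F
      ≈⟨ solve 6 (λ p₄ q₅ r₆ u₄ γ δ →
                    p₄ :* (q₅ :* r₆) :* u₄ := u₄ :* (q₅ :* r₆) :* p₄ :+ (γ :* con 0 :+ δ :* con 0))
           ≈-refl (p 4F) (q 5F) (r 6F) (coef dep 4F) (γ dep) (δ dep) ⟩
    β dep * p 4F + (γ dep * 0# + δ dep * 0#)
      ≈⟨ +-congˡ (+-cong (*-congˡ (vanishes C₀₁₂₅ dQ 4F)) (*-congˡ (vanishes C₁₂₃₆ dR 4F))) ⟨
    β dep * p 4F + (γ dep * q 4F + δ dep * r 4F) ∎
  ... | no _ | yes refl | _ = begin
    α * coef dep 5F
      ≈⟨ solve 6 (λ p₄ q₅ r₆ u₅ β δ →
                    p₄ :* (q₅ :* r₆) :* u₅ := β :* con 0 :+ (u₅ :* (p₄ :* r₆) :* q₅ :+ δ :* con 0))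
           ≈-refl (p 4F) (q 5F) (r 6F) (coef dep 5F) (β dep) (δ dep) ⟩
    β dep * 0# + (γ dep * q 5F + δ dep * 0#)
      ≈⟨ +-cong (*-congˡ (vanishes C₀₂₃₄ dP 5F)) (+-congˡ (*-congˡ (vanishes C₁₂₃₆ dR 5F))) ⟨
    β dep * p 5F + (γ dep * q 5F + δ dep * r 5F) ∎
  ... | no _ | no _ | yes refl = begin
    α * coef dep 6F
      ≈⟨ solve 6 (λ p₄ q₅ r₆ u₆ β γ →
                    p₄ :* (q₅ :* r₆) :* u₆ := β :* con 0 :+ (γ :* con 0 :+ u₆ :* (p₄ :* q₅) :* r₆))
           ≈-refl (p 4F) (q 5F) (r 6F) (coef dep 6F) (β dep) (γ dep) ⟩
    β dep * 0# + (γ dep * 0# + δ dep * r 6F)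
      ≈⟨ +-cong (*-congˡ (vanishes C₀₂₃₄ dP 6F)) (+-congʳ (*-congˡ (vanishes C₀₁₂₅ dQ 6F))) ⟨
    β dep * p 6F + (γ dep * q 6F + δ dep * r 6F) ∎
  ... | no j≢x₄ | no j≢x₅ | no j≢x₆ = begin
    α * proj₁ dep j
      ≈⟨ x≈0⇒y*x≈0 α (vanishes-outside l dep) ⟩
    0#
      ≈⟨ solve 3 (λ β γ δ → con 0 := β :* con 0 :+ (γ :* con 0 :+ δ :* con 0)) ≈-refl (β dep) (γ dep) (δ dep) ⟩
    β dep * 0# + (γ dep * 0# + δ dep * 0#)
      ≈⟨ +-cong (*-congˡ (vanishes-outside C₀₂₃₄ dP))
                (+-cong (*-congˡ (vanishes-outside C₀₁₂₅ dQ)) (*-congˡ (vanishes-outside C₁₂₃₆ dR))) ⟨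
    β dep * proj₁ dP j + (γ dep * proj₁ dQ j + δ dep * proj₁ dR j) ∎
    where
    vanishes-outside : ∀ l (dep′ : LinDependent K v (image x l)) → proj₁ dep′ j ≈ 0#
    vanishes-outside l dep′ = supported dep′ j (outside-frame l j∉B j≢x₄ j≢x₅ j≢x₆)

  combination : ∀ l (dep : LinDependent K v (image x l)) k →
    ¬ ¬ (α * coef dep k ≈ β dep * p k + (γ dep * q k + δ dep * r k))
  combination l dep k = relations-agree basis-independent
    (relation-* α (relation dep))
    (relation-+ (relation-* (β dep) (relation dP))
      (relation-+ (relation-* (γ dep) (relation dQ)) (relation-* (δ dep) (relation dR))))
    (agree-off-basis l dep) (x k)

  kernel-row : ∀ l (dep : LinDependent K v (image x l)) k {k∉l : False (k ∈ₗ? l)} →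
    ¬ ¬ (β dep * p k + (γ dep * q k + δ dep * r k) ≈ 0#)
  kernel-row l dep k {k∉l} =
    ¬¬-map (λ eq → trans (sym eq) (x≈0⇒y*x≈0 α (vanishes l dep k {k∉l}))) (combination l dep k)

  p₄≉0 : p 4F ≉ 0#
  p₄≉0 = coef≉0 C₀₂₃₄ dP 4F

  q₅≉0 : q 5F ≉ 0#
  q₅≉0 = coef≉0 C₀₁₂₅ dQ 5F

  r₆≉0 : r 6F ≉ 0#
  r₆≉0 = coef≉0 C₁₂₃₆ dR 6F

  minor₂₄₅₆ : LinDependent K v (image x C₂₄₅₆) → ¬ ¬ (p 0F * (q 1F * r 3F) + q 0F * (r 1F * p 3F) ≈ 0#)
  minor₂₄₅₆ dep = det₃≈0 β≉0
    <$> (drop-last   (x≈0⇒y*x≈0 (δ dep) (vanishes C₁₂₃₆ dR 0F)) <$> kernel-row C₂₄₅₆ dep 0F)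
    ⊛   (drop-first  (x≈0⇒y*x≈0 (β dep) (vanishes C₀₂₃₄ dP 1F)) <$> kernel-row C₂₄₅₆ dep 1F)
    ⊛   (drop-middle (x≈0⇒y*x≈0 (γ dep) (vanishes C₀₁₂₅ dQ 3F)) <$> kernel-row C₂₄₅₆ dep 3F)
    where
    β≉0 : β dep ≉ 0#
    β≉0 = *-≉0 (coef≉0 C₂₄₅₆ dep 4F) (*-≉0 q₅≉0 r₆≉0)

  minor₀₃₅₆ : LinDependent K v (image x C₀₃₅₆) → ¬ ¬ (q 1F * r 2F ≈ q 2F * r 1F)
  minor₀₃₅₆ dep = det₂≈0 γ≉0
    <$> (drop-first (x≈0⇒x*y≈0 (p 1F) β≈0) <$> kernel-row C₀₃₅₆ dep 1F)
    ⊛   (drop-first (x≈0⇒x*y≈0 (p 2F) β≈0) <$> kernel-row C₀₃₅₆ dep 2F)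
    where
    β≈0 : β dep ≈ 0#
    β≈0 = x≈0⇒x*y≈0 (q 5F * r 6F) (vanishes C₀₃₅₆ dep 4F)
    γ≉0 : γ dep ≉ 0#
    γ≉0 = *-≉0 (coef≉0 C₀₃₅₆ dep 5F) (*-≉0 p₄≉0 r₆≉0)

  minor₀₁₄₆ : LinDependent K v (image x C₀₁₄₆) → ¬ ¬ (p 2F * r 3F ≈ p 3F * r 2F)
  minor₀₁₄₆ dep = det₂≈0 β≉0
    <$> (drop-middle (x≈0⇒x*y≈0 (q 2F) γ≈0) <$> kernel-row C₀₁₄₆ dep 2F)
    ⊛   (drop-middle (x≈0⇒x*y≈0 (q 3F) γ≈0) <$> kernel-row C₀₁₄₆ dep 3F)
    where
    γ≈0 : γ dep ≈ 0#
    γ≈0 = x≈0⇒x*y≈0 (p 4F * r 6F) (vanishes C₀₁₄₆ dep 5F)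
    β≉0 : β dep ≉ 0#
    β≉0 = *-≉0 (coef≉0 C₀₁₄₆ dep 4F) (*-≉0 q₅≉0 r₆≉0)

  minor₁₃₄₅ : LinDependent K v (image x C₁₃₄₅) → ¬ ¬ (p 0F * q 2F ≈ p 2F * q 0F)
  minor₁₃₄₅ dep = det₂≈0 β≉0
    <$> (drop-last (x≈0⇒x*y≈0 (r 0F) δ≈0) <$> kernel-row C₁₃₄₅ dep 0F)
    ⊛   (drop-last (x≈0⇒x*y≈0 (r 2F) δ≈0) <$> kernel-row C₁₃₄₅ dep 2F)
    where
    δ≈0 : δ dep ≈ 0#
    δ≈0 = x≈0⇒x*y≈0 (p 4F * q 5F) (vanishes C₁₃₄₅ dep 6F)
    β≉0 : β dep ≉ 0#
    β≉0 = *-≉0 (coef≉0 C₁₃₄₅ dep 4F) (*-≉0 q₅≉0 r₆≉0)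

  ¬¬1+1≈0 : LinDependent K v (image x C₂₄₅₆) → LinDependent K v (image x C₀₃₅₆) →
    LinDependent K v (image x C₀₁₄₆) → LinDependent K v (image x C₁₃₄₅) → ¬ ¬ (1# + 1# ≈ 0#)
  ¬¬1+1≈0 d₂₄₅₆ d₀₃₅₆ d₀₁₄₆ d₁₃₄₅ = do
    det≈0 ← minor₂₄₅₆ d₂₄₅₆
    e₁ ← minor₀₃₅₆ d₀₃₅₆
    e₂ ← minor₀₁₄₆ d₀₁₄₆
    e₃ ← minor₁₃₄₅ d₁₃₄₅
    let diagonals-agree = ratio-product p₂≉0 q₂≉0 r₂≉0 e₁ e₂ e₃
    pure (x+x≈0⇒1+1≈0 diagonal≉0 (trans (+-congˡ diagonals-agree) det≈0))
    where
    p₂≉0 : p 2F ≉ 0#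
    p₂≉0 = coef≉0 C₀₂₃₄ dP 2F
    q₂≉0 : q 2F ≉ 0#
    q₂≉0 = coef≉0 C₀₁₂₅ dQ 2F
    r₂≉0 : r 2F ≉ 0#
    r₂≉0 = coef≉0 C₁₂₃₆ dR 2F
    diagonal≉0 : p 0F * (q 1F * r 3F) ≉ 0#
    diagonal≉0 = *-≉0 (coef≉0 C₀₂₃₄ dP 0F) (*-≉0 (coef≉0 C₀₁₂₅ dQ 1F) (coef≉0 C₁₂₃₆ dR 3F))

dualFano⇒¬¬1+1≈0 : ∀ {c ℓ} (K : Field c ℓ) {d n} (v : Fin d → Fin n → Field.Carrier K)
  (x : Fin 7 → Fin d) → Injective _≡_ _≡_ x →
  LinearRelations.Independent K v (image x basis) →
  (∀ l → length l ≤ 3 → LinearRelations.Independent K v (image x l)) →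
  All (λ C → LinDependent K v (image x C)) dualFanoCircuits →
  let open Field K in ¬ ¬ (1# + 1# ≈ 0#)
dualFano⇒¬¬1+1≈0 K v x x-injective basis-independent small-independent
  (dP ∷ dQ ∷ dR ∷ d₂₄₅₆ ∷ d₀₃₅₆ ∷ d₀₁₄₆ ∷ d₁₃₄₅ ∷ []) =
  DualFanoFrame.¬¬1+1≈0 K v x x-injective basis-independent small-independent dP dQ dR d₂₄₅₆ d₀₃₅₆ d₀₁₄₆ d₁₃₄₅

-- frame i orders the elements other than i so that every member of dualFanoCircuits is mapped
-- into a dependent hyperplane of M_S.
frame : Fin 8 → Vec (Fin 8) 7
frame e1 = e2 ∷ e3 ∷ e4 ∷ e6 ∷ e5 ∷ e7 ∷ e8 ∷ []
frame e2 = e1 ∷ e3 ∷ e4 ∷ e6 ∷ e7 ∷ e5 ∷ e8 ∷ []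
frame e3 = e1 ∷ e2 ∷ e4 ∷ e6 ∷ e7 ∷ e8 ∷ e5 ∷ []
frame e4 = e1 ∷ e2 ∷ e3 ∷ e8 ∷ e7 ∷ e6 ∷ e5 ∷ []
frame e5 = e1 ∷ e2 ∷ e3 ∷ e7 ∷ e8 ∷ e6 ∷ e4 ∷ []
frame e6 = e1 ∷ e2 ∷ e4 ∷ e3 ∷ e5 ∷ e8 ∷ e7 ∷ []
frame e7 = e1 ∷ e2 ∷ e3 ∷ e5 ∷ e4 ∷ e6 ∷ e8 ∷ []
frame e8 = e1 ∷ e2 ∷ e3 ∷ e4 ∷ e5 ∷ e6 ∷ e7 ∷ []

point : Fin 8 → Fin 7 → Fin 8
point i = lookup (frame i)

point-injective : ∀ i → Injective _≡_ _≡_ (point i)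
point-injective i {k} {k′} = injective i k k′
  where
  injective : ∀ i k k′ → point i k ≡ point i k′ → k ≡ k′
  injective = from-yes (all? λ i → all? λ k → all? λ k′ → point i k ≟ point i k′ →-dec k ≟ k′)

point-avoids : ∀ i k → point i k ≢ i
point-avoids = from-yes (all? λ i → all? λ k → ¬? (point i k ≟ i))

basis-sparse : ∀ i j → ∣ image (point i) basis ∩ steinerHyperplanes j ∣ ≤ 3
basis-sparse = from-yes (all? λ i → all? λ j → ∣ image (point i) basis ∩ steinerHyperplanes j ∣ ≤? 3)

circuits-in-hyperplanes : ∀ i →
  All (λ C → (∃ λ j → image (point i) C ⊆ steinerHyperplanes j) × ∣ image (point i) C ∣ ≡ 4) dualFanoCircuits
circuits-in-hyperplanes = from-yes (all? λ i → All.all? (λ C →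
    any? (λ j → image (point i) C ⊆? steinerHyperplanes j) ×-dec ∣ image (point i) C ∣ ℕ.≟ 4)
  dualFanoCircuits)

lemma6p8 : ∀ {c ℓ} (K : Field c ℓ) → CharZero K → AlgClosed K →
    (i : Fin 8) → ¬ Realizable K 4 M-S[ i ]
lemma6p8 K char0 _ i (v , realizes) =
  dualFano⇒¬¬1+1≈0 K v x (point-injective i) basis-independent small-independent circuits-dependent
    (FieldProperties.1+1≉0 K char0)
  where
  open LinearRelations K v using (Independent)
  open PavingWithLoop steinerHyperplanes i
  x : Fin 7 → Fin 8
  x = point i

  i∉image : ∀ l → i ∉ image x l
  i∉image = image-avoids x (point-avoids i)

  independent : ∀ {S} → ¬ Dependent M-S[ i ] S → Independent S
  independent {S} = contraposition (Equivalence.to (realizes S))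

  basis-independent : Independent (image x basis)
  basis-independent = independent
    (sparse⇒independent (i∉image basis) (∣image∣≤length x basis) (basis-sparse i))

  small-independent : ∀ l → length l ≤ 3 → Independent (image x l)
  small-independent l short = independent
    (∣S∣≤3⇒independent (i∉image l) (≤-trans (∣image∣≤length x l) short))

  circuits-dependent : All (λ C → LinDependent K v (image x C)) dualFanoCircuits
  circuits-dependent = All.map (λ { {C} ((j , C⊆Hj) , ∣C∣≡4) →
      Equivalence.from (realizes _) (⊆-hyperplane⇒dependent j C⊆Hj ∣C∣≡4 (i∉image C)) })
    (circuits-in-hyperplanes i)
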